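{- Let $m,n\ge1$, $\vec u,\vec v\in\widehat{\mathbb{N}}^m$ and $\vec w\in\widehat{\mathbb{N}}^n$. Then $\vec u\dotplus\vec v=\vec u\dotplus\vec w$ if and only if $\vec v=\vec w$, and $\vec v\dotplus\vec u=\vec w\dotplus\vec u$ if and only if $\vec v=\vec w$.
   Context: $Y_n$ is the set of planar rooted binary trees with $n$ internal vertices, identified with complete parenthesizations of $x_1\cdots x_{n+1}$. The name of $\tau\in Y_n$ is $(v_1,\ldots,v_n)$: $v_i=i$ if $x_i$ is immediately preceded by a left parenthesis; otherwise $x_i$ is immediately followed by a nonempty block of right parentheses and $v_i=j$ where $x_j$ is the first variable after the left parenthesis matched with the last right parenthesis of that block. $\widehat{\mathbb{N}}^n$ is the set of names of trees in $Y_n$, ordered componentwise. For $\vec v\in\widehat{\mathbb{N}}^n,\vec w\in\widehat{\mathbb{N}}^m$: $\vec v\nearrow\vec w:=(\vec v,n\triangleright\vec w)$, $\vec v\nwarrow\vec w:=(\vec v,w_1+n,\ldots,w_m+n)$, where $n\triangleright\vec w:=(n\tilde+w_1,\ldots,n\tilde+w_m)$, $n\tilde+1:=1$, $n\tilde+a:=n+a$ ($a\ne1$). The dendriform addition is the set $\vec v\dotplus\vec w:=\{\vec t\in\widehat{\mathbb{N}}^{n+m}:\ \vec v\nearrow\vec w\le\vec t\le\vec v\nwarrow\vec w\}$ (a nonempty set of names, called a grove). -}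

module Defs where

open import Data.Nat using (ℕ; zero; suc; _+_; _≤_; _≟_)
open import Data.List using (List; []; _∷_; _++_; map; length)
open import Data.List.Relation.Binary.Pointwise using (Pointwise)
open import Data.Product using (_×_; ∃)
open import Relation.Nullary using (yes; no)
open import Relation.Binary.PropositionalEquality using (_≡_)

data Tree : Set where
  leaf : Tree
  node : Tree → Tree → Tree

internal : Tree → ℕ
internal leaf       = 0
internal (node l r) = suc (internal l + internal r)

leaves : Tree → ℕ
leaves leaf       = 1
leaves (node l r) = leaves l + leaves r

-- nameFrom τ k : the name entries of the variables of the subtree τ
-- (whose variables are x_{k+1}, ..., x_{k+leaves τ}), all but the last,
-- read off the parenthesization (every product is parenthesized).
-- For a node (S_L S_R) with first variable x_{k+1}:
--   the last variable of L gets k+1 (either it is x_{k+1}, preceded by '(',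
--   or it is followed by a block of ')' ending with the closing paren of L,
--   matched with the '(' just before x_{k+1}); all other entries are as in L, R.
nameFrom : Tree → ℕ → List ℕ
nameFrom leaf       k = []
nameFrom (node l r) k = nameFrom l k ++ (suc k ∷ nameFrom r (k + leaves l))

name : Tree → List ℕ
name τ = nameFrom τ 0

-- v ∈ \hat{N}^n : v is the name of some tree in Y_n.
IsName : ℕ → List ℕ → Set
IsName n v = ∃ λ τ → internal τ ≡ n × name τ ≡ v

_~+_ : ℕ → ℕ → ℕ
n ~+ a with a ≟ 1
... | yes _ = 1
... | no  _ = n + a

_↗_ : List ℕ → List ℕ → List ℕ
v ↗ w = v ++ map (length v ~+_) w

_↖_ : List ℕ → List ℕ → List ℕ
v ↖ w = v ++ map (length v +_) w

_≤ᶜ_ : List ℕ → List ℕ → Set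
_≤ᶜ_ = Pointwise _≤_

_∈∔[_,_] : List ℕ → List ℕ → List ℕ → Set
t ∈∔[ v , w ] = IsName (length v + length w) t × (v ↗ w) ≤ᶜ t × t ≤ᶜ (v ↖ w)

{-# OPTIONS --safe #-}
module Submission where

-- A grove v ∔ w is an interval of names whose top v ↖ w is itself a name:
-- it is the name of the tree obtained by grafting the tree of w onto the
-- rightmost leaf of the tree of v. Equal groves therefore have equal tops,
-- and v ↖ w determines w given v (it ends with a shifted copy of w) and v
-- given w (by its length, it starts with v).

open import Defs
open import Data.Nat using (ℕ; suc; _+_; _≤_; _≟_)
open import Data.Nat.Properties
  using (+-assoc; +-suc; +-identityʳ; ≤-refl; ≤-antisym; m≤n+m; +-cancelˡ-≡; +-cancelʳ-≡)
open import Data.List using (List; _∷_; _++_; map; length)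
open import Data.List.Properties
  using (++-assoc; map-++; length-++; length-map; map-injective; ++-cancelˡ; ++-cancelʳ)
open import Data.List.Relation.Binary.Pointwise using (++⁺; map⁺; Pointwise-≡⇒≡)
open import Data.List.Relation.Binary.Pointwise.Properties using (refl; antisymmetric)
open import Data.Product using (_×_; _,_; proj₂)
open import Function using (_∘_)
open import Function.Bundles using (_⇔_; mk⇔; Equivalence)
open import Function.Construct.Identity using (⇔-id)
open import Relation.Nullary using (yes; no)
open import Relation.Binary.PropositionalEquality
  using (_≡_; cong; cong₂; sym; trans; subst; module ≡-Reasoning)
  renaming (refl to ≡-refl)

open ≡-Reasoning

graftRight : Tree → Tree → Tree
graftRight leaf       σ = σ
graftRight (node l r) σ = node l (graftRight r σ)

leaves≡suc-internal : ∀ τ → leaves τ ≡ suc (internal τ)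
leaves≡suc-internal leaf       = ≡-refl
leaves≡suc-internal (node l r) =
  trans (cong₂ _+_ (leaves≡suc-internal l) (leaves≡suc-internal r))
        (cong suc (+-suc (internal l) (internal r)))

internal-graftRight : ∀ τ σ → internal (graftRight τ σ) ≡ internal τ + internal σ
internal-graftRight leaf       σ = ≡-refl
internal-graftRight (node l r) σ = cong suc (begin
  internal l + internal (graftRight r σ)  ≡⟨ cong (internal l +_) (internal-graftRight r σ) ⟩
  internal l + (internal r + internal σ)  ≡⟨ +-assoc (internal l) (internal r) (internal σ) ⟨
  internal l + internal r + internal σ    ∎)

length-nameFrom : ∀ τ k → length (nameFrom τ k) ≡ internal τ
length-nameFrom leaf       k = ≡-refl
length-nameFrom (node l r) k = begin
  length (nameFrom l k ++ suc k ∷ nameFrom r (k + leaves l))  ≡⟨ length-++ (nameFrom l k) ⟩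
  length (nameFrom l k) + suc (length (nameFrom r _))         ≡⟨ cong₂ (λ a b → a + suc b) (length-nameFrom l k) (length-nameFrom r _) ⟩
  internal l + suc (internal r)                               ≡⟨ +-suc (internal l) (internal r) ⟩
  suc (internal l + internal r)                               ∎

IsName⇒length≡ : ∀ {m v} → IsName m v → length v ≡ m
IsName⇒length≡ (τ , ≡-refl , ≡-refl) = length-nameFrom τ 0

nameFrom-+ : ∀ τ j k → nameFrom τ (j + k) ≡ map (j +_) (nameFrom τ k)
nameFrom-+ leaf       j k = ≡-refl
nameFrom-+ (node l r) j k = begin
  nameFrom l (j + k) ++ suc (j + k) ∷ nameFrom r (j + k + leaves l)
    ≡⟨ cong₂ _++_ (nameFrom-+ l j k) (cong₂ _∷_ (sym (+-suc j k)) right) ⟩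
  map (j +_) (nameFrom l k) ++ map (j +_) (suc k ∷ nameFrom r (k + leaves l))
    ≡⟨ map-++ (j +_) (nameFrom l k) _ ⟨
  map (j +_) (nameFrom l k ++ suc k ∷ nameFrom r (k + leaves l))
    ∎
  where
  right : nameFrom r (j + k + leaves l) ≡ map (j +_) (nameFrom r (k + leaves l))
  right = trans (cong (nameFrom r) (+-assoc j k (leaves l))) (nameFrom-+ r j (k + leaves l))

nameFrom-graftRight : ∀ τ σ k →
  nameFrom (graftRight τ σ) k ≡ nameFrom τ k ++ nameFrom σ (k + internal τ)
nameFrom-graftRight leaf       σ k = cong (nameFrom σ) (sym (+-identityʳ k))
nameFrom-graftRight (node l r) σ k = begin
  nameFrom l k ++ suc k ∷ nameFrom (graftRight r σ) (k + leaves l)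
    ≡⟨ cong (λ x → nameFrom l k ++ suc k ∷ x) (nameFrom-graftRight r σ (k + leaves l)) ⟩
  nameFrom l k ++ suc k ∷ nameFrom r (k + leaves l) ++ nameFrom σ (k + leaves l + internal r)
    ≡⟨ cong (λ x → nameFrom l k ++ suc k ∷ nameFrom r (k + leaves l) ++ nameFrom σ x) offset ⟩
  nameFrom l k ++ suc k ∷ nameFrom r (k + leaves l) ++ nameFrom σ (k + internal (node l r))
    ≡⟨ ++-assoc (nameFrom l k) _ _ ⟨
  (nameFrom l k ++ suc k ∷ nameFrom r (k + leaves l)) ++ nameFrom σ (k + internal (node l r))
    ∎
  where
  offset : k + leaves l + internal r ≡ k + suc (internal l + internal r)
  offset = trans (+-assoc k (leaves l) (internal r))
                 (cong (λ x → k + (x + internal r)) (leaves≡suc-internal l))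

↖-isName : ∀ {m n v w} → IsName m v → IsName n w → IsName (m + n) (v ↖ w)
↖-isName (τ , ≡-refl , ≡-refl) (σ , ≡-refl , ≡-refl) =
  graftRight τ σ , internal-graftRight τ σ , (begin
    name (graftRight τ σ)                      ≡⟨ nameFrom-graftRight τ σ 0 ⟩
    name τ ++ nameFrom σ (internal τ)          ≡⟨ cong (λ k → name τ ++ nameFrom σ k) (+-identityʳ (internal τ)) ⟨
    name τ ++ nameFrom σ (internal τ + 0)      ≡⟨ cong (name τ ++_) (nameFrom-+ σ (internal τ) 0) ⟩
    name τ ++ map (internal τ +_) (name σ)     ≡⟨ cong (λ k → name τ ++ map (k +_) (name σ)) (length-nameFrom τ 0) ⟨
    name τ ↖ name σ                            ∎)

~+≤+ : ∀ n a → n ~+ a ≤ n + a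
~+≤+ n a with a ≟ 1
... | yes ≡-refl = m≤n+m 1 n
... | no  _      = ≤-refl

↗≤ᶜ↖ : ∀ v w → (v ↗ w) ≤ᶜ (v ↖ w)
↗≤ᶜ↖ v w = ++⁺ (refl ≤-refl {v}) (map⁺ _ _ (refl (λ {a} → ~+≤+ (length v) a)))

↖∈∔ : ∀ {m n v w} → IsName m v → IsName n w → (v ↖ w) ∈∔[ v , w ]
↖∈∔ {v = v} {w} pv pw =
  subst (λ k → IsName k (v ↖ w))
        (sym (cong₂ _+_ (IsName⇒length≡ pv) (IsName⇒length≡ pw)))
        (↖-isName pv pw) ,
  ↗≤ᶜ↖ v w ,
  refl ≤-refl

∔-≡⇒↖-≡ : ∀ {m n m′ n′ v w v′ w′} →
  IsName m v → IsName n w → IsName m′ v′ → IsName n′ w′ →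
  ((t : List ℕ) → (t ∈∔[ v , w ]) ⇔ (t ∈∔[ v′ , w′ ])) → v ↖ w ≡ v′ ↖ w′
∔-≡⇒↖-≡ {v = v} {w} {v′} {w′} pv pw pv′ pw′ same =
  Pointwise-≡⇒≡ (antisymmetric ≤-antisym
    (proj₂ (proj₂ (Equivalence.to   (same (v ↖ w))   (↖∈∔ pv pw))))
    (proj₂ (proj₂ (Equivalence.from (same (v′ ↖ w′)) (↖∈∔ pv′ pw′)))))

↖-cancelˡ : ∀ u {v w} → u ↖ v ≡ u ↖ w → v ≡ w
↖-cancelˡ u = map-injective (+-cancelˡ-≡ (length u) _ _) ∘ ++-cancelˡ u _ _

length-↖ : ∀ v w → length (v ↖ w) ≡ length v + length w
length-↖ v w = trans (length-++ v) (cong (length v +_) (length-map _ w))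

↖-cancelʳ : ∀ u {v w} → v ↖ u ≡ w ↖ u → v ≡ w
↖-cancelʳ u {v} {w} eq = ++-cancelʳ _ v w (subst (λ k → v ++ map (k +_) u ≡ w ↖ u) same-length eq)
  where
  same-length : length v ≡ length w
  same-length = +-cancelʳ-≡ (length u) _ _
    (trans (sym (length-↖ v u)) (trans (cong length eq) (length-↖ w u)))

proposition3p6 : (m n : ℕ) (u v w : List ℕ) → 1 ≤ m → 1 ≤ n →
    IsName m u → IsName m v → IsName n w →
    (((t : List ℕ) → (t ∈∔[ u , v ]) ⇔ (t ∈∔[ u , w ])) ⇔ (v ≡ w))
    × (((t : List ℕ) → (t ∈∔[ v , u ]) ⇔ (t ∈∔[ w , u ])) ⇔ (v ≡ w))
proposition3p6 m n u v w _ _ pu pv pw =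
  mk⇔ (↖-cancelˡ u ∘ ∔-≡⇒↖-≡ pu pv pu pw) (λ { ≡-refl _ → ⇔-id _ }) ,
  mk⇔ (↖-cancelʳ u ∘ ∔-≡⇒↖-≡ pv pu pw pu) (λ { ≡-refl _ → ⇔-id _ })
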